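{- Assume that $\beta$ is co-proper with respect to $M_{\mathbb{B}}$, which implies the existence of a finitary winning strategy $S^{\forall}_{d,\beta}$ for $\forall$ in the dual game on $\beta\colon\mathbb{B}\to\mathbb{B}$. Let $\dot b\in M_{\mathbb{B}}$ with $\dot b\not\sqsubseteq\mu\beta$ and let $F=S^{\forall}_{d,\beta}(\dot b)$ be the set of possible answers of $\forall$. For each $\dot b'\in F$ fix a dual witness $\mathit{wit}(\dot b')$ with $\deg(\mathit{wit}(\dot b'))\le\mathrm{cdeg}(\dot b')$. Let $A=\{\mathit{wit}(\dot b')\mid\dot b'\in F\}$. Then there exists $a=C_d(\dot b,A)\in J_{\mathbb{L}}$ with $a\ll\lambda(\bigsqcup A)$ and $\deg(a)\le\mathrm{cdeg}(\dot b)$ such that $a$ is a dual witness for $\dot b$, and the corresponding finitary winning strategy (for $\exists$ in the primal way-below game on $\lambda$) is $S^{\exists}_{p,\lambda}(a)=\{\mathit{wit}(\dot b')\mid\dot b'\in F\}$.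
   Context: Let $\mathbb{L},\mathbb{B}$ be complete lattices with a Galois connection $\alpha\dashv\gamma$, $\alpha\colon\mathbb{L}\to\mathbb{B}$, and monotone $\lambda\colon\mathbb{L}\to\mathbb{L}$, $\beta\colon\mathbb{B}\to\mathbb{B}$ with $\alpha\circ\lambda=\beta\circ\alpha$ (so $\alpha(\mu\lambda)=\mu\beta$). $\mathbb{L}$ is continuous with join basis $J_{\mathbb{L}}$, $\ll$ the way-below relation. Write $\bigwedge$ for meets. $\mathbb{B}$ is co-continuous with meet basis $M_{\mathbb{B}}$ (each $x=\bigwedge\{m\in M_{\mathbb{B}}\mid m\sqsupseteq x\}$), $\top\notin M_{\mathbb{B}}$; the way-above relation $x\triangleleft y$ means that for every filtered $F'$ with $\bigwedge F'\sqsubseteq x$ some $f\in F'$ satisfies $f\sqsubseteq y$, and co-continuity means $x=\bigwedge\{y\mid x\triangleleft y\}$. Co-proper: $\beta^{ -1}(\downarrow m)$ compact in the dual Scott topology for all $m\in M_{\mathbb{B}}$. Dual game on $\beta$: at $\dot b\in M_{\mathbb{B}}$, $\exists$ picks $\dot d$ with $\beta(\dot d)\sqsubseteq\dot b$; $\forall$ answers $\dot b'\in M_{\mathbb{B}}$ with $\dot d\triangleleft\dot b'$; stuck player loses, infinite plays won by $\exists$. The finitary strategy gives a finite $S^{\forall}_{d,\beta}(\dot b)\subseteq M_{\mathbb{B}}$ such that the sets $\{y\mid y\triangleleft\dot b'\}$, $\dot b'\in S^{\forall}_{d,\beta}(\dot b)$, cover $\beta^{ -1}(\downarrow\dot b)$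 and $\mathrm{cdeg}(\dot b')<\mathrm{cdeg}(\dot b)$. Primal way-below game on $\lambda$: at $a\in J_{\mathbb{L}}$, $\exists$ picks $\ell$ with $a\ll\lambda(\ell)$ (finitary: $\ell=\bigsqcup$ of a finite set $S^{\exists}_{p,\lambda}(a)$); $\forall$ picks $a'\in J_{\mathbb{L}}$, $a'\ll\ell$; infinite plays won by $\forall$. Degrees: $\deg(x)=\min\{i\mid x\ll\lambda^i(\bot)\}$, $\mathrm{cdeg}(x)=\min\{i\mid\beta^i(\bot)\not\sqsubseteq x\}$. Dual witness for $b$: $a\ll\mu\lambda$ with $\alpha(a)\not\sqsubseteq b$. $C_d(\dot b,A)$: for $\dot b\in M_{\mathbb{B}}$ and finite $A\subseteq J_{\mathbb{L}}$ with $\alpha(\lambda(\bigsqcup A))\not\sqsubseteq\dot b$, returns some $a\in J_{\mathbb{L}}$ with $a\ll\lambda(\bigsqcup A)$ and $\alpha(a)\not\sqsubseteq\dot b$. -}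

module Defs where

open import Level using (Level; suc; _⊔_)
open import Relation.Binary.Bundles using (Poset)
open import Data.Product using (Σ; ∃; _×_; _,_)
open import Data.Nat using (ℕ; zero; _<_) renaming (suc to 1+; _≤_ to _≤ℕ_)
open import Data.List using (List)
open import Data.List.Membership.Propositional using (_∈_)
open import Relation.Nullary using (¬_)
open import Relation.Binary.PropositionalEquality using (_≡_)
import Data.Empty.Polymorphic as E

record CompleteLattice (a : Level) : Set (suc a) where
  field
    poset : Poset a a a
  open Poset poset public
  field
    ⋁       : (Carrier → Set a) → Carrier
    ⋁-upper : ∀ (S : Carrier → Set a) x → S x → x ≤ ⋁ S
    ⋁-least : ∀ (S : Carrier → Set a) y → (∀ x → S x → x ≤ y) → ⋁ S ≤ y

  ⋀ : (Carrier → Set a) → Carrier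
  ⋀ S = ⋁ (λ x → ∀ s → S s → x ≤ s)

  ⊥ : Carrier
  ⊥ = ⋁ (λ _ → E.⊥)

  ⊤ : Carrier
  ⊤ = ⋀ (λ _ → E.⊥)

  IsLub : ∀ {ℓ} → (Carrier → Set ℓ) → Carrier → Set (a ⊔ ℓ)
  IsLub S x = (∀ y → S y → y ≤ x) × (∀ z → (∀ y → S y → y ≤ z) → x ≤ z)

  IsGlb : ∀ {ℓ} → (Carrier → Set ℓ) → Carrier → Set (a ⊔ ℓ)
  IsGlb S x = (∀ y → S y → x ≤ y) × (∀ z → (∀ y → S y → z ≤ y) → z ≤ x)

  Directed : ∀ {ℓ} → (Carrier → Set ℓ) → Set (a ⊔ ℓ)
  Directed D = (∃ λ x → D x)
             × (∀ x y → D x → D y → ∃ λ z → D z × x ≤ z × y ≤ z)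

  Filtered : ∀ {ℓ} → (Carrier → Set ℓ) → Set (a ⊔ ℓ)
  Filtered D = (∃ λ x → D x)
             × (∀ x y → D x → D y → ∃ λ z → D z × z ≤ x × z ≤ y)

  _≪_ : Carrier → Carrier → Set (suc a)
  x ≪ y = ∀ (D : Carrier → Set a) → Directed D → y ≤ ⋁ D → ∃ λ d → D d × x ≤ d

  _◁_ : Carrier → Carrier → Set (suc a)
  x ◁ y = ∀ (F : Carrier → Set a) → Filtered F → ⋀ F ≤ x → ∃ λ f → F f × f ≤ y

  μ : (Carrier → Carrier) → Carrier
  μ f = ⋀ (λ x → f x ≤ x)

  iter : (Carrier → Carrier) → ℕ → Carrier → Carrier
  iter f zero    x = x
  iter f (1+ n) x = f (iter f n x)

  DualScottOpen : (Carrier → Set a) → Set (suc a)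
  DualScottOpen U = (∀ x y → y ≤ x → U x → U y)
                  × (∀ (F : Carrier → Set a) → Filtered F → U (⋀ F) → ∃ λ f → F f × U f)

  DualScottCompact : (Carrier → Set a) → Set (suc a)
  DualScottCompact K =
    ∀ (I : Set a) (U : I → Carrier → Set a) →
      (∀ i → DualScottOpen (U i)) →
      (∀ x → K x → ∃ λ i → U i x) →
      ∃ λ (is : List I) → ∀ x → K x → ∃ λ i → i ∈ is × U i x

record Setting (a : Level) : Set (suc a) where
  field
    L B : CompleteLattice a
  module L = CompleteLattice L
  module B = CompleteLattice B
  _⊑L_ = L._≤_
  _⊑B_ = B._≤_
  _≪L_ = L._≪_
  _◁B_ = B._◁_
  field
    α   : L.Carrier → B.Carrier
    γ   : B.Carrier → L.Carrier
    galois : ∀ x y → (α x ⊑B y → x ⊑L γ y) × (x ⊑L γ y → α x ⊑B y)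
    lam  : L.Carrier → L.Carrier
    lam-mono : ∀ {x y} → x ⊑L y → lam x ⊑L lam y
    bet  : B.Carrier → B.Carrier
    bet-mono : ∀ {x y} → x ⊑B y → bet x ⊑B bet y
    commute : ∀ x → α (lam x) B.≈ bet (α x)
    J : L.Carrier → Set a
    J-basis : ∀ x → L.Directed (λ y → J y × y ≪L x) × L.IsLub (λ y → J y × y ≪L x) x
    M : B.Carrier → Set a
    M-basis : ∀ x → B.IsGlb (λ m → M m × x ⊑B m) x
    co-continuous : ∀ x → B.IsGlb (λ y → x ◁B y) x
    ⊤∉M : ¬ M B.⊤

  μλ : L.Carrier
  μλ = L.μ lam

  μβ : B.Carrier
  μβ = B.μ bet

  ⨆ : List L.Carrier → L.Carrier
  ⨆ A = L.⋁ (λ x → x ∈ A)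

  -- deg(x) ≤ n, where deg(x) = min { i | x ≪ λ^i(⊥) }
  DegLe : L.Carrier → ℕ → Set (suc a)
  DegLe x n = ∃ λ i → i ≤ℕ n × x ≪L L.iter lam i L.⊥

  -- cdeg(x) = n, where cdeg(x) = min { i | β^i(⊥) ⋢ x }
  IsCdeg : B.Carrier → ℕ → Set a
  IsCdeg x n = ¬ (B.iter bet n B.⊥ ⊑B x) × (∀ i → i < n → B.iter bet i B.⊥ ⊑B x)

  DualWitness : L.Carrier → B.Carrier → Set (suc a)
  DualWitness x b = x ≪L μλ × ¬ (α x ⊑B b)

  CoProper : Set (suc a)
  CoProper = ∀ m → M m → B.DualScottCompact (λ x → bet x ⊑B m)

  CdSpec : (B.Carrier → List L.Carrier → L.Carrier) → Set (suc a)
  CdSpec Cd = ∀ b (A : List L.Carrier) → M b → (∀ x → x ∈ A → J x) →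
    ¬ (α (lam (⨆ A)) ⊑B b) →
    J (Cd b A) × Cd b A ≪L lam (⨆ A) × ¬ (α (Cd b A) ⊑B b)

{-# OPTIONS --safe #-}
module Submission where

open import Defs
open import Level using (Level)
open import Data.Product using (∃; _×_; _,_; proj₁; proj₂)
open import Data.Nat using (ℕ; zero; suc; pred; _<_; z≤n; s≤s)
  renaming (_≤_ to _≤ℕ_)
open import Data.Nat.Properties using (<⇒≤pred; n<1+n; ≤-trans)
open import Data.List using (List; map)
open import Data.List.Membership.Propositional using (_∈_)
open import Data.List.Membership.Propositional.Properties using (∈-map⁺; ∈-map⁻)
open import Relation.Nullary using (¬_; contradiction)
open import Relation.Binary.PropositionalEquality using (_≡_; refl)

-- If α(λ(⨆A)) ⊑ ḃ then β(α(⨆A)) ⊑ ḃ, so α(⨆A) ◁ b' for some answer b' ∈ F;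
-- but α(wit b') ⊑ α(⨆A) ⊑ b' contradicts wit b' being a dual witness for b'. Hence C_d
-- applies and yields a ≪ λ(⨆A) with α(a) ⋢ ḃ. Since every wit b' is below μλ and below
-- λ^(cd-1)(⊥) (its degree is at most cdeg(b') < cd), a is way below both λ(μλ) ⊑ μλ and
-- λ^cd(⊥).

∈-map-∀ : ∀ {a b p} {A : Set a} {B : Set b} {P : B → Set p} (f : A → B) {xs : List A} →
          (∀ x → x ∈ xs → P (f x)) → ∀ y → y ∈ map f xs → P y
∈-map-∀ f h y y∈ with ∈-map⁻ f y∈
... | x , x∈ , refl = h x x∈

module CompleteLatticeProperties {a : Level} (L : CompleteLattice a) where
  open CompleteLattice L renaming (refl to ≤-refl)

  ⊥-minimum : ∀ x → ⊥ ≤ x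
  ⊥-minimum x = ⋁-least _ x (λ _ ())

  ⋀-lower : ∀ (S : Carrier → Set a) s → S s → ⋀ S ≤ s
  ⋀-lower S s s∈S = ⋁-least _ s (λ _ lower → lower s s∈S)

  μ-prefixpoint : ∀ {f} → (∀ {x y} → x ≤ y → f x ≤ f y) → f (μ f) ≤ μ f
  μ-prefixpoint f-mono = ⋁-upper _ _ (λ s fs≤s → trans (f-mono (⋀-lower _ s fs≤s)) fs≤s)

  iter-⊥-mono : ∀ {f} → (∀ {x y} → x ≤ y → f x ≤ f y) →
                ∀ {i k} → i ≤ℕ k → iter f i ⊥ ≤ iter f k ⊥
  iter-⊥-mono f-mono z≤n     = ⊥-minimum _
  iter-⊥-mono f-mono (s≤s i≤k) = f-mono (iter-⊥-mono f-mono i≤k)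

  singleton-directed : ∀ x → Directed (_≡ x)
  singleton-directed x = (x , refl) , λ { _ _ refl refl → x , refl , ≤-refl , ≤-refl }

  singleton-filtered : ∀ x → Filtered (_≡ x)
  singleton-filtered x = (x , refl) , λ { _ _ refl refl → x , refl , ≤-refl , ≤-refl }

  ≪⇒≤ : ∀ {x y} → x ≪ y → x ≤ y
  ≪⇒≤ {y = y} x≪y with x≪y (_≡ y) (singleton-directed y) (⋁-upper _ y refl)
  ... | _ , refl , x≤y = x≤y

  ≪-≤-trans : ∀ {x y z} → x ≪ y → y ≤ z → x ≪ z
  ≪-≤-trans x≪y y≤z D D-directed z≤⋁D = x≪y D D-directed (trans y≤z z≤⋁D)

  ◁⇒≤ : ∀ {x y} → x ◁ y → x ≤ y
  ◁⇒≤ {x} x◁y with x◁y (_≡ x) (singleton-filtered x) (⋀-lower _ x refl)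
  ... | _ , refl , x≤y = x≤y

module SettingProperties {a : Level} (S : Setting a) where
  open Setting S
  private
    module LP = CompleteLatticeProperties L
    module BP = CompleteLatticeProperties B

  α-mono : ∀ {x y} → x ⊑L y → α x ⊑B α y
  α-mono {x} {y} x⊑y = proj₂ (galois x (α y)) (L.trans x⊑y (proj₁ (galois y (α y)) B.refl))

  ⨆-map-least : ∀ {b} {B' : Set b} (f : B' → L.Carrier) {xs : List B'} {y} →
                (∀ x → x ∈ xs → f x ⊑L y) → ⨆ (map f xs) ⊑L y
  ⨆-map-least f bound = L.⋁-least _ _ (∈-map-∀ f bound)

  ⨆-map-upper : ∀ {b} {B' : Set b} (f : B' → L.Carrier) {xs : List B'} {x} →
                x ∈ xs → f x ⊑L ⨆ (map f xs)
  ⨆-map-upper f x∈xs = L.⋁-upper _ _ (∈-map⁺ f x∈xs)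

  pred-cdeg< : ∀ {x n} → IsCdeg x n → pred n < n
  pred-cdeg< {n = zero}  (⊥⋢x , _) = contradiction (BP.⊥-minimum _) ⊥⋢x
  pred-cdeg< {n = suc m} _         = n<1+n m

  DegLe⇒⊑iter : ∀ {x n k} → DegLe x n → n ≤ℕ k → x ⊑L L.iter lam k L.⊥
  DegLe⇒⊑iter (i , i≤n , x≪) n≤k =
    L.trans (LP.≪⇒≤ x≪) (LP.iter-⊥-mono lam-mono (≤-trans i≤n n≤k))

  ⨆-map-⊑-iter-pred : ∀ {b} {I : Set b} (f : I → L.Carrier) {xs : List I} {c} →
                      (∀ i → i ∈ xs → ∃ λ n → DegLe (f i) n × n < c) →
                      ⨆ (map f xs) ⊑L L.iter lam (pred c) L.⊥
  ⨆-map-⊑-iter-pred f degs = ⨆-map-least f λ i i∈xs →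
    let (n , deg-fi , n<c) = degs i i∈xs in DegLe⇒⊑iter deg-fi (<⇒≤pred n<c)

  ≪-lam-DegLe : ∀ {x y k n} → x ≪L lam y → y ⊑L L.iter lam k L.⊥ → k < n → DegLe x n
  ≪-lam-DegLe {k = k} x≪ y⊑ k<n = suc k , k<n , LP.≪-≤-trans x≪ (lam-mono y⊑)

  ≪-lam-DualWitness : ∀ {x y b} → x ≪L lam y → y ⊑L μλ → ¬ (α x ⊑B b) → DualWitness x b
  ≪-lam-DualWitness x≪ y⊑μλ αx⋢b =
    LP.≪-≤-trans x≪ (L.trans (lam-mono y⊑μλ) (LP.μ-prefixpoint lam-mono)) , αx⋢b

  α-lam-⨆-⋢ : ∀ {ḃ} (F : List B.Carrier) (wit : B.Carrier → L.Carrier) →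
              (∀ y → bet y ⊑B ḃ → ∃ λ b' → b' ∈ F × y ◁B b') →
              (∀ b' → b' ∈ F → ¬ (α (wit b') ⊑B b')) →
              ¬ (α (lam (⨆ (map wit F))) ⊑B ḃ)
  α-lam-⨆-⋢ F wit cover wit⋢ αλ⨆⊑ḃ with cover _ (B.trans (B.reflexive (B.Eq.sym (commute _))) αλ⨆⊑ḃ)
  ... | b' , b'∈F , α⨆◁b' = wit⋢ b' b'∈F (B.trans (α-mono (⨆-map-upper wit b'∈F)) (BP.◁⇒≤ α⨆◁b'))

proposition29 : ∀ {a : Level} (S : Setting a) → let open Setting S in
  CoProper →
  (Cd : B.Carrier → List L.Carrier → L.Carrier) → CdSpec Cd →
  (ḃ : B.Carrier) → M ḃ → ¬ (μβ ⊑B ḃ) →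
  (cd : ℕ) → IsCdeg ḃ cd →
  -- F = S^∀_{d,β}(ḃ): finite set of answers of ∀
  (F : List B.Carrier) →
  (∀ b' → b' ∈ F → M b') →
  (∀ y → bet y ⊑B ḃ → ∃ λ b' → b' ∈ F × y ◁B b') →
  (∀ b' → b' ∈ F → ∃ λ n → IsCdeg b' n × n < cd) →
  -- chosen dual witnesses
  (wit : B.Carrier → L.Carrier) →
  (∀ b' → b' ∈ F → J (wit b') × DualWitness (wit b') b'
                    × (∀ n → IsCdeg b' n → DegLe (wit b') n)) →
  let A = map wit F
      a = Cd ḃ A
  in J a × a ≪L lam (⨆ A) × DegLe a cd × DualWitness a ḃ
proposition29 S _ Cd Cd-spec ḃ Mḃ _ cd cdeg-ḃ F _ cover cdeg-F wit wit-spec =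
  let (J-a , a≪λ⨆A , αa⋢ḃ) = Cd-spec ḃ A Mḃ (∈-map-∀ wit wit-J) (α-lam-⨆-⋢ F wit cover α-wit⋢)
  in J-a , a≪λ⨆A , ≪-lam-DegLe a≪λ⨆A ⨆A⊑λ^pred-cd⊥ (pred-cdeg< cdeg-ḃ)
   , ≪-lam-DualWitness a≪λ⨆A ⨆A⊑μλ αa⋢ḃ
  where
  open Setting S
  open SettingProperties S

  A : List L.Carrier
  A = map wit F

  wit-J : ∀ b' → b' ∈ F → J (wit b')
  wit-J b' b'∈F = proj₁ (wit-spec b' b'∈F)

  α-wit⋢ : ∀ b' → b' ∈ F → ¬ (α (wit b') ⊑B b')
  α-wit⋢ b' b'∈F = proj₂ (proj₁ (proj₂ (wit-spec b' b'∈F)))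

  ⨆A⊑μλ : ⨆ A ⊑L μλ
  ⨆A⊑μλ = ⨆-map-least wit λ b' b'∈F →
    CompleteLatticeProperties.≪⇒≤ L (proj₁ (proj₁ (proj₂ (wit-spec b' b'∈F))))

  ⨆A⊑λ^pred-cd⊥ : ⨆ A ⊑L L.iter lam (pred cd) L.⊥
  ⨆A⊑λ^pred-cd⊥ = ⨆-map-⊑-iter-pred wit λ b' b'∈F →
    let (n , cdeg-b' , n<cd) = cdeg-F b' b'∈F
    in n , proj₂ (proj₂ (wit-spec b' b'∈F)) n cdeg-b' , n<cd
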